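{- Let $G=(L,R,E)$ be a bipartite graph, let $(A^{*},B^{*})$ be a balanced biclique of $G$, let $A\subseteq L$, $B\subseteq R$, and let $C_{A}\subseteq L\setminus A$, $C_{B}\subseteq R\setminus B$. If $u\in C_{A}$ satisfies $|N(u,G)\cap C_{B}|<|B^{*}|-|B|$, then no balanced biclique $(A',B')$ of $G$ with $A\subseteq A'\subseteq A\cup C_{A}$, $B\subseteq B'\subseteq B\cup C_{B}$ and $u\in A'$ satisfies $|A'|+|B'|>|A^{*}|+|B^{*}|$; hence $u$ may be removed from $C_{A}$. Symmetrically, if $v\in C_{B}$ satisfies $|N(v,G)\cap C_{A}|<|A^{*}|-|A|$, then no such balanced biclique with $v\in B'$ is larger than $(A^{*},B^{*})$, and $v$ may be removed from $C_{B}$.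
   Context: A biclique of a bipartite graph $G=(L,R,E)$ is a pair $(A,B)$ with $A\subseteq L$, $B\subseteq R$ and $(x,y)\in E$ for all $x\in A,y\in B$; it is balanced if $|A|=|B|$. $N(u,G)$ is the set of neighbours of $u$ in $G$. Note $|N(u,G)\cap C_B|$ is the degree of $u$ in the subgraph induced by $C_A\cup C_B$. (In the paper this is the "low degree reduction rule" for a search with partial biclique $(A,B)$, candidate sets $(C_A,C_B)$ and best biclique found so far $(A^*,B^*)$.) -}

module Defs where

open import Data.Nat using (ℕ)
open import Data.Bool using (Bool; true; false)
open import Data.Fin using (Fin)
open import Data.Fin.Subset using (Subset; _∈_; _⊆_; _∪_; _─_; ∣_∣; inside; outside)
open import Data.Vec using (tabulate)
open import Data.Product using (_×_)
open import Relation.Binary.PropositionalEquality using (_≡_)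

-- A bipartite graph G = (L, R, E) with finite sides L = Fin m, R = Fin n,
-- and edge set given by its (decidable) adjacency relation.
record BipartiteGraph (m n : ℕ) : Set where
  field
    adj : Fin m → Fin n → Bool

open BipartiteGraph public

Edge : ∀ {m n} → BipartiteGraph m n → Fin m → Fin n → Set
Edge G x y = adj G x y ≡ true

private
  toSide : Bool → Bool
  toSide true  = inside
  toSide false = outside

NL : ∀ {m n} → BipartiteGraph m n → Fin m → Subset n
NL G u = tabulate (λ y → toSide (adj G u y))

NR : ∀ {m n} → BipartiteGraph m n → Fin n → Subset m
NR G v = tabulate (λ x → toSide (adj G x v))

IsBiclique : ∀ {m n} → BipartiteGraph m n → Subset m → Subset n → Set
IsBiclique G A B = ∀ {x y} → x ∈ A → y ∈ B → Edge G x y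

IsBalancedBiclique : ∀ {m n} → BipartiteGraph m n → Subset m → Subset n → Set
IsBalancedBiclique G A B = IsBiclique G A B × ∣ A ∣ ≡ ∣ B ∣

-- Let (A′ , B′) be a balanced biclique extending the partial biclique
-- (A , B) inside the candidates (A ∪ CA , B ∪ CB), and let u ∈ A′.  Every
-- vertex of B′ is adjacent to u, so B′ ⊆ B ∪ (N(u) ∩ CB) and hence
--   ∣ B′ ∣ ≤ ∣ B ∣ + ∣ N(u) ∩ CB ∣ < ∣ B ∣ + (∣ B* ∣ ∸ ∣ B ∣) ≤ ∣ B* ∣ .
-- As both bicliques are balanced, ∣ A′ ∣ + ∣ B′ ∣ = 2∣ B′ ∣ < 2∣ B* ∣ =
-- ∣ A* ∣ + ∣ B* ∣, so (A′ , B′) is not larger than (A* , B*).  The case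
-- v ∈ B′ is the mirror image with the two sides exchanged.
module Submission where

open import Defs
open import Data.Bool using (Bool)
open import Data.Nat using (ℕ; suc; _+_; _∸_; _≤_; _<_; z≤n; s≤s)
open import Data.Nat.Properties
  using (≤-trans; ≤-reflexive; n≤1+n; +-suc; +-comm; +-monoʳ-≤; +-mono-<;
         <-≤-trans; <⇒≤; <⇒≯; n≮0; m∸n≢0⇒n<m; m≤o∸n⇒m+n≤o)
open import Data.Fin using (Fin; zero)
open import Data.Fin.Subset using (Subset; Side; _∈_; _⊆_; _∪_; _∩_; _─_; ∣_∣; ⊤; inside; outside)
open import Data.Fin.Subset.Properties using (p⊆q⇒∣p∣≤∣q∣; x∈p∩q⁺; x∈p∪q⁻; x∈p∪q⁺)
open import Data.Vec using (_∷_; []; lookup; tabulate)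
open import Data.Vec.Properties using (lookup⇒[]=; lookup∘tabulate)
open import Data.Product using (_×_; _,_)
open import Data.Sum using (inj₁; inj₂)
open import Relation.Binary.PropositionalEquality using (_≡_; refl; sym; trans; cong; subst₂)
open import Relation.Nullary using (¬_)

∣p∪q∣≤∣p∣+∣q∣ : ∀ {k} (p q : Subset k) → ∣ p ∪ q ∣ ≤ ∣ p ∣ + ∣ q ∣
∣p∪q∣≤∣p∣+∣q∣ []           []           = z≤n
∣p∪q∣≤∣p∣+∣q∣ (inside ∷ p)  (inside ∷ q)  =
  s≤s (≤-trans (∣p∪q∣≤∣p∣+∣q∣ p q) (+-monoʳ-≤ ∣ p ∣ (n≤1+n ∣ q ∣)))
∣p∪q∣≤∣p∣+∣q∣ (inside ∷ p)  (outside ∷ q) = s≤s (∣p∪q∣≤∣p∣+∣q∣ p q)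
∣p∪q∣≤∣p∣+∣q∣ (outside ∷ p) (inside ∷ q)  =
  ≤-trans (s≤s (∣p∪q∣≤∣p∣+∣q∣ p q)) (≤-reflexive (sym (+-suc ∣ p ∣ ∣ q ∣)))
∣p∪q∣≤∣p∣+∣q∣ (outside ∷ p) (outside ∷ q) = ∣p∪q∣≤∣p∣+∣q∣ p q

-- The map turning an adjacency bit into a subset side, as used by NL and
-- NR: `side (adj G u y)` is definitionally the y-th entry of NL G u.
side : Bool → Side
side b = lookup (NL {1} {1} (record { adj = λ _ _ → b }) zero) zero

∈-tabulate : ∀ {k} (f : Fin k → Side) {y} → f y ≡ inside → y ∈ tabulate f
∈-tabulate f {y} fy = lookup⇒[]= y (tabulate f) (trans (lookup∘tabulate f y) fy)

∈NL : ∀ {m n} (G : BipartiteGraph m n) {u y} → Edge G u y → y ∈ NL G u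
∈NL G {u} e = ∈-tabulate (λ y → side (adj G u y)) (cong side e)

∈NR : ∀ {m n} (G : BipartiteGraph m n) {v x} → Edge G x v → x ∈ NR G v
∈NR G {v} e = ∈-tabulate (λ x → side (adj G x v)) (cong side e)

biclique-⊆NL : ∀ {m n} (G : BipartiteGraph m n) {A′ B′ u} →
               IsBiclique G A′ B′ → u ∈ A′ → B′ ⊆ NL G u
biclique-⊆NL G bc u∈A′ y∈B′ = ∈NL G (bc u∈A′ y∈B′)

biclique-⊆NR : ∀ {m n} (G : BipartiteGraph m n) {A′ B′ v} →
               IsBiclique G A′ B′ → v ∈ B′ → A′ ⊆ NR G v
biclique-⊆NR G bc v∈B′ x∈A′ = ∈NR G (bc x∈A′ v∈B′)

-- A subset X′ of X ∪ C all of whose elements lie in N uses, outside X,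
-- only elements of N ∩ C; hence ∣ X′ ∣ ≤ ∣ X ∣ + ∣ N ∩ C ∣.
extension-size : ∀ {k} {X C N X′ : Subset k} →
                 X′ ⊆ X ∪ C → X′ ⊆ N → ∣ X′ ∣ ≤ ∣ X ∣ + ∣ N ∩ C ∣
extension-size {X = X} {C} {N} {X′} X′⊆X∪C X′⊆N =
  ≤-trans (p⊆q⇒∣p∣≤∣q∣ X′⊆X∪N∩C) (∣p∪q∣≤∣p∣+∣q∣ X (N ∩ C))
  where
  X′⊆X∪N∩C : X′ ⊆ X ∪ (N ∩ C)
  X′⊆X∪N∩C y∈X′ with x∈p∪q⁻ X C (X′⊆X∪C y∈X′)
  ... | inj₁ y∈X = x∈p∪q⁺ (inj₁ y∈X)
  ... | inj₂ y∈C = x∈p∪q⁺ (inj₂ (x∈p∩q⁺ (X′⊆N y∈X′ , y∈C)))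

-- Truncated subtraction: k < n ∸ m forces m < n, and then m + k < n.
<∸⇒+< : ∀ {k m n} → k < n ∸ m → m + k < n
<∸⇒+< {k} {m} {n} k<n∸m = subst₂ _≤_ (cong suc (+-comm k m)) refl
  (m≤o∸n⇒m+n≤o (suc k) (<⇒≤ m<n) k<n∸m)
  where
  m<n : m < n
  m<n = m∸n≢0⇒n<m (λ n∸m≡0 → n≮0 (<-≤-trans k<n∸m (≤-reflexive n∸m≡0)))

low-degree-side-small : ∀ {k s} {X C N X′ : Subset k} →
                        X′ ⊆ X ∪ C → X′ ⊆ N → ∣ N ∩ C ∣ < s ∸ ∣ X ∣ → ∣ X′ ∣ < s
low-degree-side-small X′⊆X∪C X′⊆N deg< =
  <-≤-trans (s≤s (extension-size X′⊆X∪C X′⊆N)) (<∸⇒+< deg<)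

balanced-smaller : ∀ {a′ b′ a* b* : ℕ} → a′ ≡ b′ → a* ≡ b* → b′ < b* →
                   a′ + b′ < a* + b*
balanced-smaller refl refl b′<b* = +-mono-< b′<b* b′<b*

lemma2 : ∀ {m n} (G : BipartiteGraph m n)
           (A* : Subset m) (B* : Subset n) → IsBalancedBiclique G A* B* →
           (A CA : Subset m) (B CB : Subset n) →
           CA ⊆ (⊤ ─ A) → CB ⊆ (⊤ ─ B) →
           ((u : Fin m) → u ∈ CA → ∣ NL G u ∩ CB ∣ < ∣ B* ∣ ∸ ∣ B ∣ →
             ∀ (A′ : Subset m) (B′ : Subset n) → IsBalancedBiclique G A′ B′ →
             A ⊆ A′ → A′ ⊆ (A ∪ CA) → B ⊆ B′ → B′ ⊆ (B ∪ CB) → u ∈ A′ →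
             ¬ (∣ A* ∣ + ∣ B* ∣ < ∣ A′ ∣ + ∣ B′ ∣))
         × ((v : Fin n) → v ∈ CB → ∣ NR G v ∩ CA ∣ < ∣ A* ∣ ∸ ∣ A ∣ →
             ∀ (A′ : Subset m) (B′ : Subset n) → IsBalancedBiclique G A′ B′ →
             A ⊆ A′ → A′ ⊆ (A ∪ CA) → B ⊆ B′ → B′ ⊆ (B ∪ CB) → v ∈ B′ →
             ¬ (∣ A* ∣ + ∣ B* ∣ < ∣ A′ ∣ + ∣ B′ ∣))
lemma2 G A* B* (_ , ∣A*∣≡∣B*∣) A CA B CB _ _ =
  -- u ∈ A′ confines B′ to B ∪ (N(u) ∩ CB), so ∣ B′ ∣ < ∣ B* ∣.
  (λ u _ deg< A′ B′ (bc , ∣A′∣≡∣B′∣) _ _ _ B′⊆B∪CB u∈A′ →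
    <⇒≯ (balanced-smaller ∣A′∣≡∣B′∣ ∣A*∣≡∣B*∣
          (low-degree-side-small B′⊆B∪CB (biclique-⊆NL G bc u∈A′) deg<)))
  -- v ∈ B′ confines A′ to A ∪ (N(v) ∩ CA), so ∣ A′ ∣ < ∣ A* ∣ = ∣ B* ∣.
  , (λ v _ deg< A′ B′ (bc , ∣A′∣≡∣B′∣) _ A′⊆A∪CA _ _ v∈B′ →
    <⇒≯ (balanced-smaller ∣A′∣≡∣B′∣ ∣A*∣≡∣B*∣
          (subst₂ _<_ ∣A′∣≡∣B′∣ ∣A*∣≡∣B*∣
            (low-degree-side-small A′⊆A∪CA (biclique-⊆NR G bc v∈B′) deg<))))
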